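{- Let $\Delta \ge 3$ and $c\in[0,\Delta-2]$, $\kappa=\Delta+c$. There exists an insertion sequence on a forest of maximum degree at most $\Delta$ and a tie-breaking rule such that {\textsc{Greedy}} (maintaining a proper $\kappa$-edge-coloring) has amortized recourse $\Omega\!\left(\frac{1}{c+\sqrt{\Delta}}\right)$, with an absolute constant in the $\Omega(\cdot)$.
   Context: A dynamic forest on a fixed vertex set starts with no edges; in the incremental model every update is the insertion of an edge joining two distinct trees, and the maximum degree always stays at most $\Delta$. An algorithm must maintain after every update a proper edge coloring with palette $[\kappa]$. The recourse of an update is the number of previously colored edges whose color is changed (coloring the newly inserted edge does not count); amortized recourse is total recourse divided by the number of updates. {\textsc{Greedy}} is the algorithm that, upon insertion of an edge $e$, determines a smallest set $H$ of existing edges that can be recolored so that $e$ can receive a color, and recolors $H$ and $e$ accordingly; when several such recolorings exist, a tie-breaking rule chooses one. -}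

module Defs where

open import Data.Nat using (ℕ; zero; suc; _+_; _*_; _∸_; _≤_)
open import Data.Fin using (Fin; zero; suc; _≟_)
open import Data.Bool using (if_then_else_)
open import Data.List using (List; []; _∷_; length; lookup)
open import Data.List.Membership.Propositional using (_∈_)
open import Data.Product using (Σ; _×_; _,_; proj₁; proj₂)
open import Data.Sum using (_⊎_)
open import Function using (_∘_)
open import Relation.Nullary using (¬_; does)
open import Relation.Binary.PropositionalEquality using (_≡_; _≢_)

Edge : ℕ → Set
Edge n = Fin n × Fin n

Incident : ∀ {n} → Fin n → Edge n → Set
Incident v e = proj₁ e ≡ v ⊎ proj₂ e ≡ v

SharesEndpoint : ∀ {n} → Edge n → Edge n → Set
SharesEndpoint {n} e f = Σ (Fin n) λ v → Incident v e × Incident v f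

eqInd : ∀ {n} → Fin n → Fin n → ℕ
eqInd a b = if does (a ≟ b) then 1 else 0

deg : ∀ {n} → List (Edge n) → Fin n → ℕ
deg [] v = 0
deg ((a , b) ∷ es) v = eqInd a v + eqInd b v + deg es v

MaxDegAtMost : ∀ {n} → ℕ → List (Edge n) → Set
MaxDegAtMost Δ es = ∀ v → deg es v ≤ Δ

data Conn {n} (es : List (Edge n)) : Fin n → Fin n → Set where
  here  : ∀ {u} → Conn es u u
  fwd   : ∀ {a b w} → (a , b) ∈ es → Conn es b w → Conn es a w
  bwd   : ∀ {a b w} → (a , b) ∈ es → Conn es a w → Conn es b w

-- Incremental-model update: the new edge joins two distinct trees of the
-- current forest, and the max degree stays at most Δ.
ValidInsertion : ∀ {n} → ℕ → List (Edge n) → Edge n → Set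
ValidInsertion Δ es e = ¬ Conn es (proj₁ e) (proj₂ e) × MaxDegAtMost Δ (e ∷ es)

Coloring : ∀ {n} → ℕ → List (Edge n) → Set
Coloring κ es = Fin (length es) → Fin κ

Proper : ∀ {n κ} (es : List (Edge n)) → Coloring κ es → Set
Proper es col = ∀ i j → i ≢ j → SharesEndpoint (lookup es i) (lookup es j) → col i ≢ col j

diffs : ∀ {κ} t → (Fin t → Fin κ) → (Fin t → Fin κ) → ℕ
diffs zero f g = 0
diffs (suc t) f g = (if does (f zero ≟ g zero) then 0 else 1) + diffs t (f ∘ suc) (g ∘ suc)

-- recourse of passing from col (on es) to col' (on e ∷ es, the new edge being
-- index zero): number of previously coloured edges whose colour changed
recourse : ∀ {n κ} (es : List (Edge n)) (e : Edge n) →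
           Coloring κ es → Coloring κ (e ∷ es) → ℕ
recourse es e col col' = diffs (length es) col (col' ∘ suc)

-- col' is a possible outcome of Greedy upon inserting e: it is a proper
-- colouring of e ∷ es and recolours a smallest possible set of old edges.
GreedyStep : ∀ {n κ} (es : List (Edge n)) (e : Edge n) →
             Coloring κ es → Coloring κ (e ∷ es) → Set
GreedyStep {κ = κ} es e col col' =
  Proper (e ∷ es) col' ×
  (∀ (col'' : Coloring κ (e ∷ es)) → Proper (e ∷ es) col'' →
     recourse es e col col' ≤ recourse es e col col'')

-- A run of Greedy (with some tie-breaking) on the insertion sequence whose
-- inserted edges are es (most recent first), ending in colouring col,
-- with total recourse R.
data GreedyRun {n} (Δ κ : ℕ) : (es : List (Edge n)) → Coloring κ es → ℕ → Set where
  start : GreedyRun Δ κ [] (λ ()) 0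
  step  : ∀ {es col R e col'} →
          GreedyRun Δ κ es col R →
          ValidInsertion Δ es e →
          GreedyStep es e col col' →
          GreedyRun Δ κ (e ∷ es) col' (R + recourse es e col col')

-- R / T ≥ (1/K) / (c + √Δ), i.e. T ≤ K·R·(c + √Δ), written without square
-- roots:  T ≤ K·R·c  or  (T − K·R·c)² ≤ (K·R)²·Δ.
AmortizedLowerBound : (K c Δ T R : ℕ) → Set
AmortizedLowerBound K c Δ T R =
  T ≤ K * R * c ⊎ (T ∸ K * R * c) * (T ∸ K * R * c) ≤ (K * R) * (K * R) * Δ

{-# OPTIONS --safe #-}

-- Keep a hub u whose edges carry the colours 0, …, x − 1. Grow a star at a fresh vertex v whose
-- pendant edges get the colours κ − 1, …, x: these insertions need no recolouring, so the
-- tie-breaking rule may prescribe their colours. Inserting uv then joins two trees (the star lies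
-- on vertices above all earlier ones), yet every colour is present at u or at v, so Greedy must
-- recolour some edge; recolouring the pendant edge of colour x to colour 0 suffices, and uv takes
-- x. The hub now carries 0, …, x. From a hub of degree Δ − s, s such phases cost recourse s and at
-- most Δ + s(s + c) insertions in total, and s = min(⌊√Δ⌋, Δ − c − 1) makes this at most
-- 4s(c + √Δ).

module Submission where

open import Defs
open import Data.Nat
open import Data.Nat.Properties
open import Data.Nat.Tactic.RingSolver using (solve-∀)
open import Data.Fin as Fin using (Fin; zero; suc; toℕ; fromℕ<)
open import Data.Fin.Properties using (toℕ-fromℕ<; toℕ-injective; toℕ<n)
open import Data.List using (List; _∷_; length; lookup)
open import Data.List.Membership.Propositional using (_∈_)
open import Data.List.Relation.Unary.Any using (here; there; index)
open import Data.List.Relation.Unary.Any.Properties using (lookup-index)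
open import Data.Vec.Functional using () renaming (_∷_ to _▹_)
open import Data.Unit using (⊤; tt)
open import Data.Product using (Σ; ∃-syntax; _×_; _,_; proj₁; proj₂)
open import Data.Sum using (_⊎_; inj₁; inj₂)
open import Function using (_∘_; _⇔_; mk⇔; Equivalence)
open import Relation.Nullary using (¬_; Dec; yes; no; contradiction)
open import Relation.Binary.PropositionalEquality

private
  variable
    n κ Δ : ℕ

eqInd-refl : (a : Fin n) → eqInd a a ≡ 1
eqInd-refl a with a Fin.≟ a
... | yes _  = refl
... | no a≢a = contradiction refl a≢a

eqInd-≢ : {a b : Fin n} → a ≢ b → eqInd a b ≡ 0
eqInd-≢ {a = a} {b} a≢b with a Fin.≟ b
... | yes a≡b = contradiction a≡b a≢b
... | no _    = refl

deg-pendant : (es : List (Edge n)) {v w : Fin n} → w ≢ v → deg ((v , w) ∷ es) v ≡ suc (deg es v)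
deg-pendant es {v} w≢v rewrite eqInd-refl v | eqInd-≢ w≢v = refl

deg-away : (es : List (Edge n)) {a b v : Fin n} → a ≢ v → b ≢ v → deg ((a , b) ∷ es) v ≡ deg es v
deg-away es a≢v b≢v rewrite eqInd-≢ a≢v | eqInd-≢ b≢v = refl

incident⇒deg>0 : (es : List (Edge n)) {v : Fin n} (i : Fin (length es)) →
                 Incident v (lookup es i) → 0 < deg es v
incident⇒deg>0 ((a , b) ∷ es) zero (inj₁ refl) rewrite eqInd-refl a = s≤s z≤n
incident⇒deg>0 ((a , b) ∷ es) zero (inj₂ refl) rewrite eqInd-refl b =
  ≤-trans (m≤n+m 1 (eqInd a b)) (m≤m+n _ (deg es b))
incident⇒deg>0 ((a , b) ∷ es) {v} (suc i) inc =
  ≤-trans (incident⇒deg>0 es i inc) (m≤n+m (deg es v) (eqInd a v + eqInd b v))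

deg≡0⇒¬incident : (es : List (Edge n)) {v : Fin n} → deg es v ≡ 0 →
                  ∀ i → ¬ Incident v (lookup es i)
deg≡0⇒¬incident es deg≡0 i inc = <⇒≢ (incident⇒deg>0 es i inc) (sym deg≡0)

∈⇒deg>0 : {es : List (Edge n)} {a b : Fin n} → (a , b) ∈ es → 0 < deg es a × 0 < deg es b
∈⇒deg>0 {es = es} e∈es =
  incident⇒deg>0 es (index e∈es) (inj₁ (cong proj₁ (sym (lookup-index e∈es)))) ,
  incident⇒deg>0 es (index e∈es) (inj₂ (cong proj₂ (sym (lookup-index e∈es))))

EdgeClosed : (Fin n → Set) → List (Edge n) → Set
EdgeClosed P es = ∀ {a b} → (a , b) ∈ es → P a ⇔ P b

Conn-preserves : {es : List (Edge n)} {P : Fin n → Set} → EdgeClosed P es →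
                 ∀ {x y} → Conn es x y → P x → P y
Conn-preserves closed here        px = px
Conn-preserves closed (fwd e∈ c) pa = Conn-preserves closed c (Equivalence.to (closed e∈) pa)
Conn-preserves closed (bwd e∈ c) pb = Conn-preserves closed c (Equivalence.from (closed e∈) pb)

¬Conn-unused : {es : List (Edge n)} {v w : Fin n} → deg es w ≡ 0 → v ≢ w → ¬ Conn es v w
¬Conn-unused {es = es} {w = w} deg≡0 v≢w c = Conn-preserves closed c v≢w refl
  where
  used : ∀ {a} → 0 < deg es a → a ≢ w
  used deg>0 refl = <⇒≢ deg>0 (sym deg≡0)
  closed : EdgeClosed (_≢ w) es
  closed e∈ = let (a>0 , b>0) = ∈⇒deg>0 e∈ in mk⇔ (λ _ → used b>0) (λ _ → used a>0)

record Unused (es : List (Edge n)) (next : ℕ) : Set where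
  constructor unused-from
  field
    deg≡0 : ∀ v → next ≤ toℕ v → deg es v ≡ 0

open Unused

Unused-suc : {es : List (Edge n)} {next : ℕ} → Unused es next → Unused es (suc next)
Unused-suc unused = unused-from λ v lt → deg≡0 unused v (<⇒≤ lt)

Unused-∷ : {es : List (Edge n)} {next : ℕ} {a b : Fin n} → Unused es next →
           toℕ a < next → toℕ b < next → Unused ((a , b) ∷ es) next
Unused-∷ {es = es} unused a<next b<next = unused-from λ v le →
  let below : ∀ {x} → toℕ x < _ → x ≢ v
      below x<next x≡v = <⇒≱ x<next (subst (λ y → _ ≤ toℕ y) (sym x≡v) le)
  in trans (deg-away es (below a<next) (below b<next)) (deg≡0 unused v le)

deg>0⇒below : {es : List (Edge n)} {next : ℕ} → Unused es next →
              ∀ {x} → 0 < deg es x → toℕ x < next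
deg>0⇒below {next = next} unused {x} deg>0 with toℕ x <? next
... | yes lt = lt
... | no ≮   = contradiction (deg≡0 unused x (≮⇒≥ ≮)) (≢-sym (<⇒≢ deg>0))

Unused⇒EdgeClosed : {es : List (Edge n)} {next : ℕ} → Unused es next →
                    EdgeClosed (λ x → toℕ x < next) es
Unused⇒EdgeClosed {es = es} unused e∈ =
  let (a>0 , b>0) = ∈⇒deg>0 e∈
  in mk⇔ (λ _ → deg>0⇒below unused b>0) (λ _ → deg>0⇒below unused a>0)

MaxDegAtMost-∷ : {es : List (Edge n)} {a b : Fin n} → MaxDegAtMost Δ es →
                 suc (deg es a) ≤ Δ → suc (deg es b) ≤ Δ → a ≢ b → MaxDegAtMost Δ ((a , b) ∷ es)
MaxDegAtMost-∷ {a = a} {b} maxDeg room-a room-b a≢b x with a Fin.≟ x | b Fin.≟ x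
... | yes refl | yes refl = contradiction refl a≢b
... | yes refl | no _     = room-a
... | no _     | yes refl = room-b
... | no _     | no _     = maxDeg x

Free : (es : List (Edge n)) → Coloring κ es → Fin n → Fin κ → Set
Free es col v z = ∀ i → Incident v (lookup es i) → col i ≢ z

Proper-▹ : {e : Edge n} {es : List (Edge n)} {col : Coloring κ es} {z : Fin κ} → Proper es col →
           (∀ i → SharesEndpoint e (lookup es i) → z ≢ col i) → Proper (e ∷ es) (z ▹ col)
Proper-▹ proper fresh zero    zero    i≢j _                  = contradiction refl i≢j
Proper-▹ proper fresh zero    (suc j) _   shared             = fresh j shared
Proper-▹ proper fresh (suc i) zero    _   (v , inc₁ , inc₂) = ≢-sym (fresh i (v , inc₂ , inc₁))
Proper-▹ proper fresh (suc i) (suc j) i≢j shared             = proper i j (i≢j ∘ cong suc) shared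

Proper-pendant : {es : List (Edge n)} {col : Coloring κ es} {v w : Fin n} {z : Fin κ} →
                 Proper es col → deg es w ≡ 0 → Free es col v z → Proper ((v , w) ∷ es) (z ▹ col)
Proper-pendant {es = es} {col} {v} {w} {z} proper w-unused z-free = Proper-▹ proper fresh
  where
  fresh : ∀ i → SharesEndpoint (v , w) (lookup es i) → z ≢ col i
  fresh i (_ , inj₁ refl , inc) = ≢-sym (z-free i inc)
  fresh i (_ , inj₂ refl , inc) = contradiction inc (deg≡0⇒¬incident es w-unused i)

diffs-refl : ∀ t (f : Fin t → Fin κ) → diffs t f f ≡ 0
diffs-refl zero    f = refl
diffs-refl (suc t) f with f zero Fin.≟ f zero
... | yes _ = diffs-refl t (f ∘ suc)
... | no ≢  = contradiction refl ≢

diffs≡0⇒≗ : ∀ t (f g : Fin t → Fin κ) → diffs t f g ≡ 0 → f ≗ g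
diffs≡0⇒≗ (suc t) f g d≡0 i with f zero Fin.≟ g zero
diffs≡0⇒≗ (suc t) f g d≡0 zero    | yes eq = eq
diffs≡0⇒≗ (suc t) f g d≡0 (suc i) | yes _  = diffs≡0⇒≗ t (f ∘ suc) (g ∘ suc) d≡0 i

diffs-head : ∀ {t} {a b : Fin κ} (f : Fin t → Fin κ) → a ≢ b → diffs (suc t) (a ▹ f) (b ▹ f) ≡ 1
diffs-head {t = t} {a} {b} f a≢b with a Fin.≟ b
... | yes a≡b = contradiction a≡b a≢b
... | no _    = cong suc (diffs-refl t f)

Blocked : (es : List (Edge n)) → Coloring κ es → Edge n → Set
Blocked es col e = ∀ z → ∃[ i ] SharesEndpoint e (lookup es i) × col i ≡ z

GreedyStep-keep : {es : List (Edge n)} {e : Edge n} {col : Coloring κ es} {z : Fin κ} →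
                  Proper (e ∷ es) (z ▹ col) → GreedyStep es e col (z ▹ col)
GreedyStep-keep {es = es} {col = col} proper =
  proper , λ _ _ → ≤-trans (≤-reflexive (diffs-refl (length es) col)) z≤n

Blocked⇒recourse>0 : {es : List (Edge n)} {e : Edge n} {col : Coloring κ es} {col' : Coloring κ (e ∷ es)} →
                     Blocked es col e → Proper (e ∷ es) col' → 0 < recourse es e col col'
Blocked⇒recourse>0 {es = es} {e} {col} {col'} blocked proper' = n≢0⇒n>0 unchanged⇒⊥
  where
  unchanged⇒⊥ : recourse es e col col' ≢ 0
  unchanged⇒⊥ r≡0 =
    let (i , shared , coli≡) = blocked (col' zero)
        same = diffs≡0⇒≗ (length es) col (col' ∘ suc) r≡0 i
    in proper' zero (suc i) (λ ()) shared (sym (trans (sym same) coli≡))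

GreedyStep-recolourOne : {es : List (Edge n)} {e : Edge n} {col : Coloring κ es} {col' : Coloring κ (e ∷ es)} →
                         Blocked es col e → Proper (e ∷ es) col' → recourse es e col col' ≡ 1 →
                         GreedyStep es e col col'
GreedyStep-recolourOne blocked proper' r≡1 =
  proper' , λ col'' proper'' → ≤-trans (≤-reflexive r≡1) (Blocked⇒recourse>0 blocked proper'')

GreedyRun⇒Proper : {es : List (Edge n)} {col : Coloring κ es} {R : ℕ} → GreedyRun Δ κ es col R → Proper es col
GreedyRun⇒Proper start                    ()
GreedyRun⇒Proper (step _ _ (proper , _)) = proper

GreedyRun⇒MaxDegAtMost : {es : List (Edge n)} {col : Coloring κ es} {R : ℕ} → GreedyRun Δ κ es col R →
                         MaxDegAtMost Δ es
GreedyRun⇒MaxDegAtMost start                    _ = z≤n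
GreedyRun⇒MaxDegAtMost (step _ (_ , maxDeg) _) = maxDeg

GreedyRun-nonempty : {es : List (Edge n)} {col : Coloring κ es} {R : ℕ} → GreedyRun Δ κ es col R →
                     0 < R → 0 < length es
GreedyRun-nonempty (step _ _ _) _ = s≤s z≤n

record ColoursAt (es : List (Edge n)) (col : Coloring κ es) (v : Fin n) (lo hi : ℕ) : Set where
  field
    degree : lo + deg es v ≡ hi
    within : ∀ i → Incident v (lookup es i) → lo ≤ toℕ (col i) × toℕ (col i) < hi
    onto   : ∀ (z : Fin κ) → lo ≤ toℕ z → toℕ z < hi → ∃[ i ] Incident v (lookup es i) × col i ≡ z

open ColoursAt

ColoursAt-unused : {es : List (Edge n)} {col : Coloring κ es} {v : Fin n} →
                   ∀ m → deg es v ≡ 0 → ColoursAt es col v m m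
ColoursAt-unused {es = es} m deg≡0 = record
  { degree = trans (cong (m +_) deg≡0) (+-identityʳ m)
  ; within = λ i inc → contradiction inc (deg≡0⇒¬incident es deg≡0 i)
  ; onto   = λ z m≤z z<m → contradiction (≤-<-trans m≤z z<m) (<-irrefl refl)
  }

ColoursAt-away : {es : List (Edge n)} {col : Coloring κ es} {a b v : Fin n} {z : Fin κ} {lo hi : ℕ} →
                 a ≢ v → b ≢ v → ColoursAt es col v lo hi → ColoursAt ((a , b) ∷ es) (z ▹ col) v lo hi
ColoursAt-away {es = es} {lo = lo} a≢v b≢v C = record
  { degree = trans (cong (lo +_) (deg-away es a≢v b≢v)) (degree C)
  ; within = λ { zero (inj₁ a≡v) → contradiction a≡v a≢v
               ; zero (inj₂ b≡v) → contradiction b≡v b≢v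
               ; (suc i) inc → within C i inc }
  ; onto   = λ z lo≤z z<hi → let (i , inc , coli≡z) = onto C z lo≤z z<hi in suc i , inc , coli≡z
  }

ColoursAt-below : {es : List (Edge n)} {col : Coloring κ es} {v w : Fin n} {z : Fin κ} {lo hi : ℕ} →
                  w ≢ v → toℕ z ≡ lo →
                  ColoursAt es col v (suc lo) hi → ColoursAt ((v , w) ∷ es) (z ▹ col) v lo hi
ColoursAt-below {es = es} {col} {v} {w} {z} {lo} {hi} w≢v z≡lo C = record
  { degree = trans (cong (lo +_) (deg-pendant es w≢v)) (trans (+-suc lo (deg es v)) (degree C))
  ; within = λ { zero _ → ≤-reflexive (sym z≡lo)
                        , subst (_≤ hi) (cong suc (sym z≡lo)) (≤-trans (m≤m+n _ _) (≤-reflexive (degree C)))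
               ; (suc i) inc → let (lo<c , c<hi) = within C i inc in <⇒≤ lo<c , c<hi }
  ; onto   = ontoBelow
  }
  where
  ontoBelow : ∀ z' → lo ≤ toℕ z' → toℕ z' < hi → ∃[ i ] Incident v (lookup ((v , w) ∷ es) i) × (z ▹ col) i ≡ z'
  ontoBelow z' lo≤z' z'<hi with toℕ z' ≟ lo
  ... | yes z'≡lo = zero , inj₁ refl , toℕ-injective (trans z≡lo (sym z'≡lo))
  ... | no z'≢lo  = let (i , inc , coli≡z') = onto C z' (≤∧≢⇒< lo≤z' (z'≢lo ∘ sym)) z'<hi
                    in suc i , inc , coli≡z'

ColoursAt-above : {es : List (Edge n)} {col : Coloring κ es} {v w : Fin n} {z : Fin κ} {lo hi : ℕ} →
                  w ≢ v → toℕ z ≡ hi →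
                  ColoursAt es col v lo hi → ColoursAt ((v , w) ∷ es) (z ▹ col) v lo (suc hi)
ColoursAt-above {es = es} {col} {v} {w} {z} {lo} {hi} w≢v z≡hi C = record
  { degree = trans (cong (lo +_) (deg-pendant es w≢v)) (trans (+-suc lo (deg es v)) (cong suc (degree C)))
  ; within = λ { zero _ → subst (lo ≤_) (sym z≡hi) (≤-trans (m≤m+n lo _) (≤-reflexive (degree C)))
                        , s≤s (≤-reflexive z≡hi)
               ; (suc i) inc → let (lo≤c , c<hi) = within C i inc in lo≤c , m<n⇒m<1+n c<hi }
  ; onto   = ontoAbove
  }
  where
  ontoAbove : ∀ z' → lo ≤ toℕ z' → toℕ z' < suc hi → ∃[ i ] Incident v (lookup ((v , w) ∷ es) i) × (z ▹ col) i ≡ z'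
  ontoAbove z' lo≤z' z'≤hi with toℕ z' ≟ hi
  ... | yes z'≡hi = zero , inj₁ refl , toℕ-injective (trans z≡hi (sym z'≡hi))
  ... | no z'≢hi  = let (i , inc , coli≡z') = onto C z' lo≤z' (≤∧≢⇒< (s≤s⁻¹ z'≤hi) z'≢hi)
                    in suc i , inc , coli≡z'

ColoursAt-free : {es : List (Edge n)} {col : Coloring κ es} {v : Fin n} {z : Fin κ} {lo hi : ℕ} →
                 ColoursAt es col v lo hi → toℕ z < lo ⊎ hi ≤ toℕ z → Free es col v z
ColoursAt-free C outside i inc refl with within C i inc | outside
... | lo≤z , _ | inj₁ z<lo = <⇒≱ z<lo lo≤z
... | _ , z<hi | inj₂ hi≤z = <⇒≱ z<hi hi≤z

ColoursAt-blocked : {es : List (Edge n)} {col : Coloring κ es} {u v : Fin n} {x : ℕ} →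
                    ColoursAt es col u 0 x → ColoursAt es col v x κ → Blocked es col (u , v)
ColoursAt-blocked {x = x} U V z with toℕ z <? x
... | yes z<x = let (i , inc , coli≡z) = onto U z z≤n z<x in i , (_ , inj₁ refl , inc) , coli≡z
... | no z≮x  = let (i , inc , coli≡z) = onto V z (≮⇒≥ z≮x) (toℕ<n z) in i , (_ , inj₂ refl , inc) , coli≡z

EdgeClosed-∷ : {es : List (Edge n)} {P : Fin n → Set} {a b : Fin n} →
               (P a ⇔ P b) → EdgeClosed P es → EdgeClosed P ((a , b) ∷ es)
EdgeClosed-∷ a⇔b closed (here refl) = a⇔b
EdgeClosed-∷ a⇔b closed (there e∈)  = closed e∈

¬Conn-across : {es : List (Edge n)} {B : ℕ} {u v : Fin n} → EdgeClosed (λ y → toℕ y < B) es →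
               toℕ u < B → B ≤ toℕ v → ¬ Conn es u v
¬Conn-across closed u<B B≤v c = <⇒≱ (Conn-preserves closed c u<B) B≤v

both-false : {A B : Set} → ¬ A → ¬ B → A ⇔ B
both-false ¬a ¬b = mk⇔ (λ a → contradiction a ¬a) (λ b → contradiction b ¬b)

GreedyStep-recolourPendant :
  {es : List (Edge n)} {col : Coloring κ es} {u v w : Fin n} {x̂ ŷ : Fin κ} {x : ℕ} →
  Proper es col → deg es w ≡ 0 → w ≢ u → w ≢ v → v ≢ u →
  ColoursAt es col u 0 x → ColoursAt es col v (suc x) κ → toℕ x̂ ≡ x → toℕ ŷ < x →
  GreedyStep ((v , w) ∷ es) (u , v) (x̂ ▹ col) (x̂ ▹ (ŷ ▹ col)) ×
  recourse ((v , w) ∷ es) (u , v) (x̂ ▹ col) (x̂ ▹ (ŷ ▹ col)) ≡ 1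
GreedyStep-recolourPendant {es = es} {col} {u} {v} {w} {x̂} {ŷ} proper w-unused w≢u w≢v v≢u U V x̂≡x ŷ<x =
  GreedyStep-recolourOne blocked proper' recourse≡1 , recourse≡1
  where
  x̂≢ŷ : x̂ ≢ ŷ
  x̂≢ŷ x̂≡ŷ = <-irrefl (trans (cong toℕ (sym x̂≡ŷ)) x̂≡x) ŷ<x
  blocked : Blocked ((v , w) ∷ es) (x̂ ▹ col) (u , v)
  blocked = ColoursAt-blocked (ColoursAt-away v≢u w≢u U) (ColoursAt-below w≢v x̂≡x V)
  x̂-fresh : ∀ i → SharesEndpoint (u , v) (lookup ((v , w) ∷ es) i) → x̂ ≢ (ŷ ▹ col) i
  x̂-fresh zero    _                 = x̂≢ŷ
  x̂-fresh (suc i) (_ , inj₁ refl , inc) = ≢-sym (ColoursAt-free U (inj₂ (≤-reflexive (sym x̂≡x))) i inc)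
  x̂-fresh (suc i) (_ , inj₂ refl , inc) = ≢-sym (ColoursAt-free V (inj₁ (s≤s (≤-reflexive x̂≡x))) i inc)
  proper' : Proper ((u , v) ∷ (v , w) ∷ es) (x̂ ▹ (ŷ ▹ col))
  proper' = Proper-▹ (Proper-pendant proper w-unused (ColoursAt-free V (inj₁ (m<n⇒m<1+n ŷ<x)))) x̂-fresh
  recourse≡1 : recourse ((v , w) ∷ es) (u , v) (x̂ ▹ col) (x̂ ▹ (ŷ ▹ col)) ≡ 1
  recourse≡1 = diffs-head col x̂≢ŷ

subinterval-size≤ : ∀ {lo m d hi} → lo ≤ m → m + d ≡ hi → hi ≤ lo + Δ → d ≤ Δ
subinterval-size≤ {Δ = Δ} {lo} {d = d} lo≤m m+d≡hi hi≤lo+Δ =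
  +-cancelˡ-≤ lo d Δ (≤-trans (+-monoˡ-≤ d lo≤m) (≤-trans (≤-reflexive m+d≡hi) hi≤lo+Δ))

+-shift-≤ : ∀ m a {x y} → x ≤ y → (m + a) + x ≤ a + (m + y)
+-shift-≤ m a {x} x≤y = ≤-trans (≤-reflexive (rearrange m a x)) (+-monoʳ-≤ a (+-monoʳ-≤ m x≤y))
  where
  rearrange : ∀ m a x → (m + a) + x ≡ a + (m + x)
  rearrange = solve-∀

module Construction (Δ κ N : ℕ) where

  Vertex : Set
  Vertex = Fin (suc N)

  Edges : Set
  Edges = List (Edge (suc N))

  hub : Vertex
  hub = zero

  Reachable : ℕ → ℕ → ((es : Edges) → Coloring κ es → Set) → Set
  Reachable R next P = Σ Edges λ es → Σ (Coloring κ es) λ col →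
                       GreedyRun Δ κ es col R × Unused es next × P es col

  attach : ∀ {es col R next} (v : Vertex) (z : Fin κ) (next<n : next < suc N) →
           GreedyRun Δ κ es col R → Unused es next → toℕ v < next → suc (deg es v) ≤ Δ → Free es col v z →
           let es' = (v , fromℕ< next<n) ∷ es in
           GreedyRun Δ κ es' (z ▹ col) R × Unused es' (suc next)
  attach {es} {col} {R} {next} v z next<n run unused v<next v-room z-free =
    subst (GreedyRun Δ κ _ _) (trans (cong (R +_) (diffs-refl (length es) col)) (+-identityʳ R))
          (step run valid (GreedyStep-keep proper')) ,
    Unused-∷ (Unused-suc unused) (m<n⇒m<1+n v<next) (s≤s (≤-reflexive w≡next))
    where
    w : Vertex
    w = fromℕ< next<n
    w≡next : toℕ w ≡ next
    w≡next = toℕ-fromℕ< next<n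
    w-unused : deg es w ≡ 0
    w-unused = deg≡0 unused w (≤-reflexive (sym w≡next))
    v≢w : v ≢ w
    v≢w refl = <-irrefl w≡next v<next
    proper' : Proper ((v , w) ∷ es) (z ▹ col)
    proper' = Proper-pendant (GreedyRun⇒Proper run) w-unused z-free
    valid : ValidInsertion Δ es (v , w)
    valid = ¬Conn-unused w-unused v≢w ,
            MaxDegAtMost-∷ {es = es} (GreedyRun⇒MaxDegAtMost run) v-room
              (subst (λ d → suc d ≤ Δ) (sym w-unused) (≤-trans (s≤s z≤n) v-room)) v≢w

  PendantStable : Vertex → ((es : Edges) → Coloring κ es → Set) → ℕ → Set
  PendantStable v P next = ∀ {es col} w z → next ≤ toℕ w → P es col → P ((v , w) ∷ es) (z ▹ col)

  attachPendants :
    ∀ k {es col R next lo hi} (v : Vertex) (P : (es : Edges) → Coloring κ es → Set) →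
    PendantStable v P next → GreedyRun Δ κ es col R → Unused es next →
    ColoursAt es col v (k + lo) hi → P es col →
    toℕ v < next → k + next ≤ suc N → hi ≤ lo + Δ → hi ≤ κ →
    Reachable R (k + next) λ es' col' → ColoursAt es' col' v lo hi × P es' col' × length es' ≡ k + length es
  attachPendants zero v P stable run unused C p _ _ _ _ = _ , _ , run , unused , C , p , refl
  attachPendants (suc k) {es} {col} {R} {next} {lo} {hi} v P stable run unused C p v<next budget hi≤lo+Δ hi≤κ
    =
    let run₁ , unused₁ = attach v z next<n run unused v<next v-room z-free
        es' , col' , run' , unused' , C' , p' , length≡ =
          attachPendants k v P stable′ run₁ unused₁ (ColoursAt-below w≢v z≡k+lo C)
                         (stable w z (≤-reflexive (sym w≡next)) p) (m<n⇒m<1+n v<next)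
                         (subst (_≤ suc N) (sym (+-suc k next)) budget) hi≤lo+Δ hi≤κ
    in es' , col' , run' , subst (Unused es') (+-suc k next) unused' , C' , p' , trans length≡ (+-suc k (length es))
    where
    k+lo<κ : k + lo < κ
    k+lo<κ = ≤-trans (m≤m+n _ _) (≤-trans (≤-reflexive (degree C)) hi≤κ)
    z : Fin κ
    z = fromℕ< k+lo<κ
    z≡k+lo : toℕ z ≡ k + lo
    z≡k+lo = toℕ-fromℕ< k+lo<κ
    z-free : Free es col v z
    z-free = ColoursAt-free C (inj₁ (s≤s (≤-reflexive z≡k+lo)))
    v-room : suc (deg es v) ≤ Δ
    v-room = subinterval-size≤ (m≤n+m lo k) (trans (+-suc (k + lo) (deg es v)) (degree C)) hi≤lo+Δ
    next<n : next < suc N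
    next<n = ≤-trans (s≤s (m≤n+m next k)) budget
    w : Vertex
    w = fromℕ< next<n
    w≡next : toℕ w ≡ next
    w≡next = toℕ-fromℕ< next<n
    w≢v : w ≢ v
    w≢v refl = <-irrefl w≡next v<next
    stable′ : PendantStable v P (suc next)
    stable′ w z lt = stable w z (<⇒≤ lt)

  forcedStep :
    ∀ {es col R next B x} (u v : Vertex) → next < suc N →
    GreedyRun Δ κ es col R → Unused es next → EdgeClosed (λ y → toℕ y < B) es →
    toℕ u < B → B ≤ toℕ v → toℕ v < next →
    ColoursAt es col u 0 x → ColoursAt es col v (suc x) κ → 0 < x → suc x ≤ Δ → suc κ ≤ x + Δ →
    Reachable (suc R) (suc next) λ es' col' → ColoursAt es' col' u 0 (suc x) × length es' ≡ 2 + length es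
  forcedStep {es} {col} {R} {next} {B} {x} u v next<n run unused closed u<B B≤v v<next U V x>0 u-room v-room =
    let run₁ , unused₁ = attach v x̂ next<n run unused v<next (≤-trans (n≤1+n _) v-room₂)
                                (ColoursAt-free V (inj₁ (s≤s (≤-reflexive x̂≡x))))
        greedy , recourse≡1 = GreedyStep-recolourPendant {x̂ = x̂} {ŷ} (GreedyRun⇒Proper run) w-unused
                                w≢u w≢v v≢u U V x̂≡x ŷ<x
        valid : ValidInsertion Δ ((v , w) ∷ es) (u , v)
        valid = ¬Conn-across closed′ u<B B≤v , MaxDegAtMost-∷ {es = (v , w) ∷ es} (GreedyRun⇒MaxDegAtMost run₁) u-room′ v-room′ (v≢u ∘ sym)
    in _ , _ , subst (GreedyRun Δ κ _ _) (trans (cong (R +_) recourse≡1) (+-comm R 1)) (step run₁ valid greedy) ,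
       Unused-∷ unused₁ (m<n⇒m<1+n u<next) (m<n⇒m<1+n v<next) ,
       ColoursAt-above v≢u x̂≡x (ColoursAt-away v≢u w≢u U) , refl
    where
    x<κ : x < κ
    x<κ = ≤-trans (m≤m+n (suc x) _) (≤-reflexive (degree V))
    x̂ ŷ : Fin κ
    x̂ = fromℕ< x<κ
    ŷ = fromℕ< (≤-<-trans z≤n x<κ)
    x̂≡x : toℕ x̂ ≡ x
    x̂≡x = toℕ-fromℕ< x<κ
    ŷ<x : toℕ ŷ < x
    ŷ<x = subst (_< x) (sym (toℕ-fromℕ< (≤-<-trans z≤n x<κ))) x>0
    w : Vertex
    w = fromℕ< next<n
    w≡next : toℕ w ≡ next
    w≡next = toℕ-fromℕ< next<n
    w-unused : deg es w ≡ 0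
    w-unused = deg≡0 unused w (≤-reflexive (sym w≡next))
    u<next : toℕ u < next
    u<next = <-≤-trans u<B (≤-trans B≤v (<⇒≤ v<next))
    w≢u : w ≢ u
    w≢u refl = <-irrefl w≡next u<next
    w≢v : w ≢ v
    w≢v refl = <-irrefl w≡next v<next
    v≢u : v ≢ u
    v≢u refl = <⇒≱ u<B B≤v
    v-room₂ : 2 + deg es v ≤ Δ
    v-room₂ = subinterval-size≤ ≤-refl (trans (+-suc x (suc (deg es v))) (cong suc (trans (+-suc x (deg es v)) (degree V)))) v-room
    u-room′ : suc (deg ((v , w) ∷ es) u) ≤ Δ
    u-room′ = subst (λ d → suc d ≤ Δ) (sym (degree (ColoursAt-away {z = x̂} v≢u w≢u U))) u-room
    v-room′ : suc (deg ((v , w) ∷ es) v) ≤ Δ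
    v-room′ = subst (λ d → suc d ≤ Δ) (sym (deg-pendant es w≢v)) v-room₂
    closed′ : EdgeClosed (λ y → toℕ y < B) ((v , w) ∷ es)
    closed′ = EdgeClosed-∷ (both-false (≤⇒≯ B≤v) (≤⇒≯ (≤-trans B≤v (<⇒≤ (subst (toℕ v <_) (sym w≡next) v<next))))) closed

  phase :
    ∀ p {es col R next x} →
    GreedyRun Δ κ es col R → Unused es next → 0 < next → ColoursAt es col hub 0 x →
    p + suc x ≡ κ → 0 < x → suc x ≤ Δ → 2 + p ≤ Δ → 2 + p + next ≤ suc N →
    Reachable (suc R) (2 + p + next) λ es' col' →
      ColoursAt es' col' hub 0 (suc x) × length es' ≡ 2 + p + length es
  phase p {es} {col} {R} {next} {x} run unused next>0 H p+x+1≡κ x>0 hub-room v-room budget =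
    let es₁ , col₁ , run₁ , unused₁ , V₁ , (H₁ , closed₁) , length₁ =
          attachPendants p v HubAndCut stable run (Unused-suc unused) V₀ (H , Unused⇒EdgeClosed unused)
                         (s≤s (≤-reflexive v≡next)) (≤-trans (≤-reflexive (+-suc p next)) (<⇒≤ budget))
                         (≤-trans (n≤1+n κ) (≤-trans κ-room (+-monoˡ-≤ Δ (n≤1+n x)))) ≤-refl
        es₂ , col₂ , run₂ , unused₂ , H₂ , length₂ =
          forcedStep hub v (≤-trans (≤-reflexive (cong suc (+-suc p next))) budget) run₁ unused₁ closed₁
                     next>0 (≤-reflexive (sym v≡next)) (≤-trans (s≤s (≤-reflexive v≡next)) (m≤n+m (suc next) p))
                     H₁ V₁ x>0 hub-room κ-room
    in es₂ , col₂ , run₂ , subst (Unused es₂) (cong suc (+-suc p next)) unused₂ , H₂ ,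
       trans length₂ (cong (2 +_) length₁)
    where
    next<n : next < suc N
    next<n = ≤-trans (s≤s (m≤n+m next (suc p))) budget
    v : Vertex
    v = fromℕ< next<n
    v≡next : toℕ v ≡ next
    v≡next = toℕ-fromℕ< next<n
    V₀ : ColoursAt es col v (p + suc x) κ
    V₀ = subst (λ lo → ColoursAt es col v lo κ) (sym p+x+1≡κ)
               (ColoursAt-unused κ (deg≡0 unused v (≤-reflexive (sym v≡next))))
    κ-room : suc κ ≤ x + Δ
    κ-room = ≤-trans (≤-reflexive (cong suc (trans (sym p+x+1≡κ) (+-suc p x))))
                     (≤-trans (+-monoˡ-≤ x v-room) (≤-reflexive (+-comm Δ x)))
    HubAndCut : (es : Edges) → Coloring κ es → Set
    HubAndCut es col = ColoursAt es col hub 0 x × EdgeClosed (λ y → toℕ y < next) es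
    stable : PendantStable v HubAndCut (suc next)
    stable w z next<w (H , closed) =
      ColoursAt-away v≢hub w≢hub H ,
      EdgeClosed-∷ (both-false (≤⇒≯ (≤-reflexive (sym v≡next))) (≤⇒≯ (<⇒≤ next<w))) closed
      where
      v≢hub : v ≢ hub
      v≢hub v≡hub = <-irrefl (trans (cong toℕ (sym v≡hub)) v≡next) next>0
      w≢hub : w ≢ hub
      w≢hub refl = <⇒≱ (s≤s z≤n) next<w

  -- With t phases to go the hub has degree Δ − t, so the next phase inserts t + c + 1 edges.
  phases :
    ∀ {c} → Δ + c ≡ κ → ∀ t {es col R next x} →
    GreedyRun Δ κ es col R → Unused es next → 0 < next → ColoursAt es col hub 0 x →
    t + x ≡ Δ → suc c ≤ x → next + t * suc (t + c) ≤ suc N →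
    Σ Edges λ es' → Σ (Coloring κ es') λ col' →
      GreedyRun Δ κ es' col' (t + R) × length es' ≤ length es + t * suc (t + c)
  phases _ zero run _ _ _ _ _ _ = _ , _ , run , m≤m+n _ 0
  phases {c} Δ+c≡κ (suc t) {es} {col} {R} {next} {x} run unused next>0 H t+x≡Δ c<x budget =
    let es₁ , col₁ , run₁ , unused₁ , H₁ , length₁ =
          phase (t + c) run unused next>0 H p+x+1≡κ (≤-trans (s≤s z≤n) c<x) hub-room v-room
                (≤-trans (≤-reflexive (+-comm m next)) (≤-trans (+-monoʳ-≤ next (m≤m+n m _)) budget))
        es₂ , col₂ , run₂ , length₂ =
          phases Δ+c≡κ t run₁ unused₁ (≤-trans next>0 (m≤n+m next m)) H₁ (trans (+-suc t x) t+x≡Δ) (m≤n⇒m≤1+n c<x)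
                 (≤-trans (+-shift-≤ m next later≤) budget)
    in es₂ , col₂ , subst (GreedyRun Δ κ es₂ col₂) (+-suc t R) run₂ ,
       ≤-trans length₂ (≤-trans (+-monoˡ-≤ _ (≤-reflexive length₁)) (+-shift-≤ m (length es) later≤))
    where
    m : ℕ
    m = 2 + (t + c)
    later≤ : t * suc (t + c) ≤ t * m
    later≤ = *-monoʳ-≤ t (n≤1+n _)
    p+x+1≡κ : (t + c) + suc x ≡ κ
    p+x+1≡κ = trans (size t c x) (trans (cong (_+ c) t+x≡Δ) Δ+c≡κ)
      where
      size : ∀ t c x → (t + c) + suc x ≡ (suc t + x) + c
      size = solve-∀
    hub-room : suc x ≤ Δ
    hub-room = ≤-trans (s≤s (m≤n+m x t)) (≤-reflexive t+x≡Δ)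
    v-room : m ≤ Δ
    v-room = ≤-trans (≤-reflexive (cong suc (sym (+-suc t c)))) (≤-trans (+-monoʳ-≤ (suc t) c<x) (≤-reflexive t+x≡Δ))

greedyRun-withRecourse : ∀ Δ c s → s + c < Δ →
  Σ ℕ λ n → Σ (List (Edge n)) λ es → Σ (Coloring (Δ + c) es) λ col →
    GreedyRun Δ (Δ + c) es col s × length es ≤ Δ + s * (s + c)
greedyRun-withRecourse Δ c s s+c<Δ =
  let open Construction Δ (Δ + c) (a + s * suc (s + c))
      es₀ , col₀ , run₀ , unused₀ , H₀ , _ , length₀ =
        attachPendants a hub (λ _ _ → ⊤) (λ _ _ _ _ → tt) start (unused-from λ _ _ → refl)
                       (ColoursAt-unused (a + 0) refl) tt (s≤s z≤n)
                       (≤-trans (≤-reflexive (+-comm a 1)) (s≤s (m≤m+n a _))) a+0≤Δ (≤-trans a+0≤Δ (m≤m+n Δ c))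
      es , col , run , length≤ =
        phases refl s run₀ unused₀ (m≤n+m 1 a) H₀ (trans (cong (s +_) (+-identityʳ a)) (m+[n∸m]≡n s≤Δ))
               (≤-trans c<a (≤-reflexive (sym (+-identityʳ a))))
               (≤-reflexive (cong (_+ s * suc (s + c)) (+-comm a 1)))
  in suc (a + s * suc (s + c)) , es , col , subst (GreedyRun Δ (Δ + c) es col) (+-identityʳ s) run ,
     ≤-trans length≤ (≤-reflexive (trans (cong (_+ s * suc (s + c)) length₀) (total-length a s c Δ (m∸n+n≡m s≤Δ))))
  where
  a : ℕ
  a = Δ ∸ s
  s≤Δ : s ≤ Δ
  s≤Δ = ≤-trans (m≤m+n s c) (<⇒≤ s+c<Δ)
  a+0≤Δ : a + 0 ≤ Δ
  a+0≤Δ = ≤-trans (≤-reflexive (+-identityʳ a)) (m∸n≤m Δ s)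
  c<a : suc c ≤ a
  c<a = m+n≤o⇒m≤o∸n (suc c) (≤-trans (≤-reflexive (cong suc (+-comm c s))) s+c<Δ)
  total-length : ∀ a s c Δ → a + s ≡ Δ → (a + 0) + s * suc (s + c) ≡ Δ + s * (s + c)
  total-length a s c Δ a+s≡Δ = trans (rearrange a s c) (cong (_+ s * (s + c)) a+s≡Δ)
    where
    rearrange : ∀ a s c → (a + 0) + s * suc (s + c) ≡ (a + s) + s * (s + c)
    rearrange = solve-∀

isqrt : ∀ m → ∃[ q ] q * q ≤ m × m < suc q * suc q
isqrt zero = 0 , z≤n , s≤s z≤n
isqrt (suc m) with isqrt m
... | q , q²≤m , m<⟨q+1⟩² with suc q * suc q ≤? suc m
...   | yes ⟨q+1⟩²≤ = suc q , ⟨q+1⟩²≤ , ≤-<-trans m<⟨q+1⟩² (*-mono-< (n<1+n (suc q)) (n<1+n (suc q)))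
...   | no ⟨q+1⟩²≰  = q , m≤n⇒m≤1+n q²≤m , ≰⇒> ⟨q+1⟩²≰

AmortizedLowerBound-intro : ∀ K c Δ T R q → T ≤ K * R * c + K * R * q → q * q ≤ Δ →
                            AmortizedLowerBound K c Δ T R
AmortizedLowerBound-intro K c Δ T R q T≤ q²≤Δ with T ≤? K * R * c
... | yes T≤KRc = inj₁ T≤KRc
... | no _      = inj₂ (≤-trans (*-mono-≤ excess≤ excess≤)
                               (≤-trans (≤-reflexive (square (K * R) q)) (*-monoʳ-≤ (K * R * (K * R)) q²≤Δ)))
  where
  excess≤ : T ∸ K * R * c ≤ K * R * q
  excess≤ = m≤n+o⇒m∸n≤o T (K * R * c) T≤
  square : ∀ x q → x * q * (x * q) ≡ x * x * (q * q)
  square = solve-∀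

square-bound : ∀ {Δ q} → 0 < q → Δ < suc q * suc q → Δ ≤ 3 * (q * q)
square-bound {Δ} {q@(suc _)} _ Δ<⟨q+1⟩² =
  ≤-trans (s≤s⁻¹ Δ<⟨q+1⟩²) (≤-trans (+-mono-≤ q≤q² (≤-reflexive (*-suc q q)))
    (≤-trans (+-monoʳ-≤ (q * q) (+-monoˡ-≤ (q * q) q≤q²)) (≤-reflexive (triple (q * q)))))
  where
  q≤q² : q ≤ q * q
  q≤q² = m≤m*n q q
  triple : ∀ x → x + (x + x) ≡ 3 * x
  triple = solve-∀

double≤square : ∀ {Δ} q → 3 ≤ Δ → q * q ≤ Δ → q + q ≤ Δ
double≤square zero          3≤Δ _    = ≤-trans z≤n 3≤Δ
double≤square (suc zero)    3≤Δ _    = ≤-trans (s≤s (s≤s z≤n)) 3≤Δ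
double≤square (suc (suc r)) _   q²≤Δ =
  ≤-trans (≤-reflexive (double r)) (≤-trans (*-monoʳ-≤ (2 + r) (s≤s (s≤s (z≤n {r})))) q²≤Δ)
  where
  double : ∀ r → (2 + r) + (2 + r) ≡ (2 + r) * 2
  double = solve-∀

+-cancel-double : ∀ {Δ} q c → q + q ≤ Δ → Δ ≤ q + c → Δ ≤ c + c
+-cancel-double {Δ} q c 2q≤Δ Δ≤q+c =
  +-cancelˡ-≤ Δ Δ (c + c) (≤-trans (+-mono-≤ Δ≤q+c Δ≤q+c)
                                   (≤-trans (≤-reflexive (swap q c)) (+-monoˡ-≤ (c + c) 2q≤Δ)))
  where
  swap : ∀ q c → (q + c) + (q + c) ≡ (q + q) + (c + c)
  swap = solve-∀

length-bound-sqrt : ∀ {Δ q} c → 0 < q → Δ < suc q * suc q → Δ + q * (q + c) ≤ 4 * q * c + 4 * q * q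
length-bound-sqrt {Δ} {q} c q>0 Δ<⟨q+1⟩² =
  ≤-trans (+-monoˡ-≤ (q * (q + c)) (square-bound q>0 Δ<⟨q+1⟩²))
          (≤-trans (m≤m+n _ (3 * q * c)) (≤-reflexive (collect q c)))
  where
  collect : ∀ q c → 3 * (q * q) + q * (q + c) + 3 * q * c ≡ 4 * q * c + 4 * q * q
  collect = solve-∀

length-bound-short : ∀ {Δ q c s} → 3 ≤ Δ → q * q ≤ Δ → 0 < s → s < q → s + suc c ≡ Δ →
                     Δ + s * (s + c) ≤ 4 * s * c + 4 * s * q
length-bound-short {Δ} {q} {c} {s} 3≤Δ q²≤Δ s>0 s<q s+c+1≡Δ =
  ≤-trans (+-mono-≤ (≤-trans Δ≤2c (+-mono-≤ c≤sc c≤sc)) (*-monoʳ-≤ s (+-monoˡ-≤ c (<⇒≤ s<q))))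
          (≤-trans (m≤m+n _ (s * c + 3 * s * q)) (≤-reflexive (collect s c q)))
  where
  Δ≤2c : Δ ≤ c + c
  Δ≤2c = +-cancel-double q c (double≤square q 3≤Δ q²≤Δ)
                         (≤-trans (≤-reflexive (trans (sym s+c+1≡Δ) (+-suc s c))) (+-monoˡ-≤ c s<q))
  c≤sc : c ≤ s * c
  c≤sc = m≤n*m c s {{>-nonZero s>0}}
  collect : ∀ s c q → (s * c + s * c) + s * (q + c) + (s * c + 3 * s * q) ≡ 4 * s * c + 4 * s * q
  collect = solve-∀

phaseCount : ∀ {Δ c} q → 3 ≤ Δ → c ≤ Δ ∸ 2 → q * q ≤ Δ → Δ < suc q * suc q →
             ∃[ s ] 0 < s × s + c < Δ × Δ + s * (s + c) ≤ 4 * s * c + 4 * s * q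
phaseCount {Δ} {c} q 3≤Δ c≤Δ∸2 q²≤Δ Δ<⟨q+1⟩² = choose (q ≤? Δ ∸ suc c)
  where
  c+1<Δ : suc c < Δ
  c+1<Δ = ≤-trans (≤-reflexive (+-comm 2 c)) (m≤o∸n⇒m+n≤o c (≤-trans (s≤s (s≤s z≤n)) 3≤Δ) c≤Δ∸2)
  q>0 : 0 < q
  q>0 = n≢0⇒n>0 λ { refl → <⇒≱ Δ<⟨q+1⟩² (≤-trans (s≤s z≤n) 3≤Δ) }
  choose : Dec (q ≤ Δ ∸ suc c) → ∃[ s ] 0 < s × s + c < Δ × Δ + s * (s + c) ≤ 4 * s * c + 4 * s * q
  choose (yes q≤Δ-c-1) =
    q , q>0 , ≤-trans (≤-reflexive (sym (+-suc q c))) (m≤o∸n⇒m+n≤o q (<⇒≤ c+1<Δ) q≤Δ-c-1) ,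
    length-bound-sqrt c q>0 Δ<⟨q+1⟩²
  choose (no q≰Δ-c-1) =
    Δ ∸ suc c , s>0 , ≤-reflexive (trans (sym (+-suc (Δ ∸ suc c) c)) s+c+1≡Δ) ,
    length-bound-short 3≤Δ q²≤Δ s>0 (≰⇒> q≰Δ-c-1) s+c+1≡Δ
    where
    s+c+1≡Δ : Δ ∸ suc c + suc c ≡ Δ
    s+c+1≡Δ = m∸n+n≡m (<⇒≤ c+1<Δ)
    s>0 : 0 < Δ ∸ suc c
    s>0 = m+n≤o⇒m≤o∸n 1 c+1<Δ

theorem2p2 : Σ ℕ λ K → 1 ≤ K ×
    (∀ (Δ c : ℕ) → 3 ≤ Δ → c ≤ Δ ∸ 2 →
      Σ ℕ λ n → Σ (List (Edge n)) λ es → Σ (Coloring (Δ + c) es) λ col → Σ ℕ λ R →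
        GreedyRun Δ (Δ + c) es col R × 1 ≤ length es ×
        AmortizedLowerBound K c Δ (length es) R)
theorem2p2 = 4 , s≤s z≤n , λ Δ c 3≤Δ c≤Δ∸2 →
  let q , q²≤Δ , Δ<⟨q+1⟩² = isqrt Δ
      s , s>0 , s+c<Δ , length-budget = phaseCount q 3≤Δ c≤Δ∸2 q²≤Δ Δ<⟨q+1⟩²
      n , es , col , run , length≤ = greedyRun-withRecourse Δ c s s+c<Δ
  in n , es , col , s , run , GreedyRun-nonempty run s>0 ,
     AmortizedLowerBound-intro 4 c Δ (length es) s q (≤-trans length≤ length-budget) q²≤Δ
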